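{- Let $\mathbb{F}$ be a finite field, let $k,d$ be positive integers, and let $C$ be an integer with $0\le C\leq \frac{k}{2}-1$. If $S\subset \mathbb{F}^{d}$ is $(k,k+C)$-subspace evasive, then $$|S|\leq 4k|\mathbb{F}|^{\frac{d}{\lfloor k/(2(C+1))\rfloor}}.$$
   Context: For a finite field $\mathbb{F}$, positive integers $k\le d$ and a positive integer $c$, a set $S\subset\mathbb{F}^d$ is called $(k,c)$-subspace evasive if every $k$-dimensional affine subspace of $\mathbb{F}^d$ contains at most $c$ elements of $S$. -}

module Defs where

open import Level using (Level; _⊔_)
open import Data.Nat using (ℕ; zero; suc)
open import Data.Fin using (Fin) renaming (zero to fz; suc to fs)
open import Data.List using (List; length)
open import Data.Product using (Σ; _×_; ∃)
open import Relation.Nullary using (¬_)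
open import Algebra.Bundles using (CommutativeRing)
open import Relation.Binary.Bundles using (Setoid)
import Data.List.Relation.Unary.Unique.Setoid as UniqueS
import Data.List.Relation.Unary.Enumerates.Setoid as EnumS
import Data.List.Relation.Unary.All as All

record Field (c ℓ : Level) : Set (Level.suc (c ⊔ ℓ)) where
  field
    commRing : CommutativeRing c ℓ
  open CommutativeRing commRing public
  field
    1≉0     : ¬ (1# ≈ 0#)
    inverse : ∀ x → ¬ (x ≈ 0#) → Σ Carrier (λ y → (x * y) ≈ 1#)

record FiniteField (c ℓ : Level) : Set (Level.suc (c ⊔ ℓ)) where
  field
    fld : Field c ℓ
  open Field fld public hiding (commRing)
  field
    elements    : List Carrier
    enumerates  : EnumS.IsEnumeration setoid elements
    noDuplicate : UniqueS.Unique setoid elements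

  card : ℕ
  card = length elements

module _ {c ℓ : Level} (F : FiniteField c ℓ) where
  open FiniteField F

  Point : ℕ → Set c
  Point d = Fin d → Carrier

  _≈ᵖ_ : {d : ℕ} → Point d → Point d → Set ℓ
  x ≈ᵖ y = ∀ i → x i ≈ y i

  pointSetoid : ℕ → Setoid c ℓ
  pointSetoid d = record
    { Carrier = Point d
    ; _≈_ = _≈ᵖ_
    ; isEquivalence = record
      { refl = λ i → refl
      ; sym = λ p i → sym (p i)
      ; trans = λ p q i → trans (p i) (q i) } }

  _+ᵖ_ : {d : ℕ} → Point d → Point d → Point d
  (x +ᵖ y) i = x i + y i

  _·ᵖ_ : {d : ℕ} → Carrier → Point d → Point d
  (a ·ᵖ x) i = a * x i

  0ᵖ : {d : ℕ} → Point d
  0ᵖ i = 0#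

  lincomb : {d : ℕ} (k : ℕ) → (Fin k → Carrier) → (Fin k → Point d) → Point d
  lincomb zero    t v = 0ᵖ
  lincomb (suc k) t v = (t fz ·ᵖ v fz) +ᵖ lincomb k (λ i → t (fs i)) (λ i → v (fs i))

  LinearlyIndependent : {d : ℕ} (k : ℕ) → (Fin k → Point d) → Set (c ⊔ ℓ)
  LinearlyIndependent k v = ∀ (t : Fin k → Carrier) → lincomb k t v ≈ᵖ 0ᵖ → ∀ i → t i ≈ 0#

  record AffineSubspace (d k : ℕ) : Set (c ⊔ ℓ) where
    field
      base  : Point d
      dir   : Fin k → Point d
      indep : LinearlyIndependent k dir

  _∈ᴬ_ : {d k : ℕ} → Point d → AffineSubspace d k → Set (c ⊔ ℓ)
  x ∈ᴬ A = ∃ λ (t : Fin _ → Carrier) → x ≈ᵖ (AffineSubspace.base A +ᵖ lincomb _ t (AffineSubspace.dir A))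

  IsPointSet : {d : ℕ} → List (Point d) → Set (c ⊔ ℓ)
  IsPointSet {d} S = UniqueS.Unique (pointSetoid d) S

  _⊆ˢ_ : {d : ℕ} → List (Point d) → List (Point d) → Set (c ⊔ ℓ)
  _⊆ˢ_ {d} T S = All.All (λ x → x ∈ₛ S) T
    where open import Data.List.Membership.Setoid (pointSetoid d) renaming (_∈_ to _∈ₛ_)

  SubspaceEvasive : {d : ℕ} (k c' : ℕ) → List (Point d) → Set (c ⊔ ℓ)
  SubspaceEvasive {d} k c' S =
    (A : AffineSubspace d k) (T : List (Point d)) →
    UniqueS.Unique (pointSetoid d) T → T ⊆ˢ S → All.All (λ x → x ∈ᴬ A) T →
    length T Data.Nat.≤ c'

-- Let r = C + 1, m = ⌊k/2r⌋, g = ⌊|S|/k⌋, and cut r·m·g points of S into r blocks of m groups of g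
-- points.  If g^m > |F|^d, then in each block two different choices of one point per group have the
-- same sum, so at a group where they differ, the second choice lies in the span of the other 2m - 1
-- chosen points.  Completing these at most 2rm ≤ k spanning points by further points of S to k points
-- D, the span of D is contained in a k-dimensional subspace holding D and the r points just found:
-- k + C + 1 points of S, a contradiction.  Hence g^m ≤ |F|^d, and |S| ≤ 2gk (or |S| < 2k) gives the
-- bound, even with 2k in place of 4k.
module Submission where

open import Defs
open import Level using (Level; _⊔_)
open import Function using (_∘_; id)
open import Data.Nat as ℕ using (ℕ; zero; suc; _≤_; _<_; s≤s; z≤n; NonZero)
open import Data.Nat.Properties using (≮⇒≥)
import Data.Nat.Properties as ℕP
open import Data.Fin as Fin using (Fin; combine; remQuot; finToFun; funToFin)
open import Data.Fin.Properties as FinP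
  using (funToFin-finToFin; finToFun-funToFin; remQuot-combine; ¬∀⟶∃¬)
open import Data.Product using (∃; ∃₂; _×_; _,_; proj₁; proj₂; uncurry)
open import Data.List using (List; length; lookup; tabulate; allFin; filter; take; _++_; map)
open import Data.List.Properties using (length-tabulate; length-++; length-take; length-map; take++drop≡id)
open import Data.List.Relation.Unary.All as All using (All; []; _∷_)
open import Data.List.Relation.Unary.AllPairs using ([]; _∷_)
open import Data.List.Relation.Unary.Any using (index)
open import Data.List.Relation.Unary.Any.Properties using (lookup-index)
import Data.Vec.Functional as V
import Data.Vec.Functional.Relation.Binary.Equality.Setoid as VecEq
open import Relation.Nullary using (Dec; yes; no; contradiction)
open import Relation.Nullary.Decidable using (map′)
open import Relation.Binary.Bundles using (Setoid)
open import Relation.Binary.Definitions using (Decidable)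
open import Relation.Binary.PropositionalEquality as ≡ using (_≡_; _≢_; _≗_; cong)

private
  variable
    a ℓ : Level

-- Finite setoids and the pigeonhole principle

funToFin-cong : ∀ {m n} {f g : Fin m → Fin n} → f ≗ g → funToFin f ≡ funToFin g
funToFin-cong {zero}  f≗g = ≡.refl
funToFin-cong {suc m} f≗g = ≡.cong₂ combine (f≗g Fin.zero) (funToFin-cong (f≗g ∘ Fin.suc))

finToFun-injective : ∀ {m n} {s s' : Fin (n ℕ.^ m)} → finToFun s ≗ finToFun s' → s ≡ s'
finToFun-injective {m} {n} {s} {s'} eq = begin
  s                              ≡⟨ funToFin-finToFin {m} {n} s ⟨
  funToFin (finToFun {n} {m} s)  ≡⟨ funToFin-cong {m} {n} eq ⟩
  funToFin (finToFun {n} {m} s') ≡⟨ funToFin-finToFin {m} {n} s' ⟩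
  s'                             ∎
  where open ≡.≡-Reasoning

record HasSize (A : Setoid a ℓ) (size : ℕ) : Set (a ⊔ ℓ) where
  open Setoid A
  field
    decode           : Fin size → Carrier
    encode           : Carrier → Fin size
    decode-encode    : ∀ x → decode (encode x) ≈ x
    decode-injective : ∀ {i j} → decode i ≈ decode j → i ≡ j

  encode-cong : ∀ {x y} → x ≈ y → encode x ≡ encode y
  encode-cong x≈y = decode-injective (trans (decode-encode _) (trans x≈y (sym (decode-encode _))))

  encode-injective : ∀ {x y} → encode x ≡ encode y → x ≈ y
  encode-injective {x} {y} eq =
    trans (sym (decode-encode x)) (trans (reflexive (cong decode eq)) (decode-encode y))

  _≟_ : Decidable _≈_
  x ≟ y = map′ encode-injective encode-cong (encode x Fin.≟ encode y)

  pigeonhole : ∀ {n} → size < n → (f : Fin n → Carrier) → ∃₂ λ i j → i Fin.< j × f i ≈ f j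
  pigeonhole size<n f with i , j , i<j , eq ← FinP.pigeonhole size<n (encode ∘ f) =
    i , j , i<j , encode-injective eq

module _ {A : Setoid a ℓ} where
  open Setoid A
  open VecEq A using (≋-setoid)

  vector-hasSize : ∀ {q} → HasSize A q → ∀ n → HasSize (≋-setoid n) (q ℕ.^ n)
  vector-hasSize {q} A# n = record
    { decode           = λ s → E.decode ∘ finToFun s
    ; encode           = λ v → funToFin (E.encode ∘ v)
    ; decode-encode    = λ v i →
        trans (reflexive (cong E.decode (finToFun-funToFin (E.encode ∘ v) i))) (E.decode-encode (v i))
    ; decode-injective = λ eq → finToFun-injective {n} {q} (E.decode-injective ∘ eq)
    }
    where module E = HasSize A#

module _ (S : Setoid a ℓ) where
  open Setoid S using (_≈_; sym)
  open import Data.List.Membership.Setoid S using (_∈_)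
  open import Data.List.Membership.Setoid.Properties using (∈-lookup; index-injective)
  open import Data.List.Membership.Propositional.Properties as ∈ₚ using ()
  open import Data.List.Relation.Binary.Subset.Setoid S using (_⊆_)
  open import Data.List.Relation.Unary.Unique.Setoid S using (Unique)

  Unique-lookup-injective : ∀ {xs} → Unique xs → ∀ {i j} → lookup xs i ≈ lookup xs j → i ≡ j
  Unique-lookup-injective (_  ∷ _) {Fin.zero}  {Fin.zero}  _  = ≡.refl
  Unique-lookup-injective (x≉ ∷ _) {Fin.zero}  {Fin.suc j} eq = contradiction eq (All.lookup x≉ (∈ₚ.∈-lookup j))
  Unique-lookup-injective (x≉ ∷ _) {Fin.suc i} {Fin.zero}  eq =
    contradiction (sym eq) (All.lookup x≉ (∈ₚ.∈-lookup i))
  Unique-lookup-injective (_  ∷ u) {Fin.suc i} {Fin.suc j} eq = cong Fin.suc (Unique-lookup-injective u eq)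

  Unique-length-≤ : ∀ {xs ys} → Unique xs → xs ⊆ ys → length xs ≤ length ys
  Unique-length-≤ {xs} {ys} uniq xs⊆ys = ≮⇒≥ λ ys<xs →
    let i , j , i<j , eq = FinP.pigeonhole ys<xs (index ∘ member) in
    FinP.<⇒≢ i<j (Unique-lookup-injective uniq (index-injective S (member i) (member j) eq))
    where
    member : ∀ i → lookup xs i ∈ ys
    member i = xs⊆ys (∈-lookup S xs i)

-- Linear algebra in F^d

module _ {c ℓ} (F : FiniteField c ℓ) where
  open FiniteField F
  open import Relation.Unary using (Pred; _∈_; _∉_; _⊆_)
  open import Algebra.Solver.Ring.NaturalCoefficients.Default commutativeSemiring
  open import Algebra.Properties.Ring ring using (-1*x≈-x)
  open import Algebra.Properties.AbelianGroup +-abelianGroup using (//-rightDividesʳ)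

  FiniteField-hasSize : HasSize setoid card
  FiniteField-hasSize = record
    { decode           = lookup elements
    ; encode           = index ∘ enumerates
    ; decode-encode    = λ x → sym (lookup-index (enumerates x))
    ; decode-injective = Unique-lookup-injective setoid noDuplicate
    }

  open HasSize FiniteField-hasSize using (_≟_)

  card≥2 : 2 ≤ card
  card≥2 = Unique-length-≤ setoid (((λ 0≈1 → 1≉0 (sym 0≈1)) ∷ []) ∷ [] ∷ []) (λ _ → enumerates _)

  module _ {d : ℕ} where
    open Setoid (pointSetoid F d) using ()
      renaming (_≈_ to _≋_; refl to ≋-refl; sym to ≋-sym; trans to ≋-trans)

    private
      infixl 6 _⊕_
      infixr 7 _⊙_

      Pt : Set c
      Pt = Point F d

      _⊕_ : Pt → Pt → Pt
      _⊕_ = _+ᵖ_ F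

      _⊙_ : Carrier → Pt → Pt
      _⊙_ = _·ᵖ_ F

    lincomb-cong : ∀ k {t t' : Fin k → Carrier} (v : Fin k → Pt) →
                   (∀ i → t i ≈ t' i) → lincomb F k t v ≋ lincomb F k t' v
    lincomb-cong zero    v t≈t' x = refl
    lincomb-cong (suc k) v t≈t' x =
      +-cong (*-cong (t≈t' Fin.zero) refl) (lincomb-cong k (V.tail v) (t≈t' ∘ Fin.suc) x)

    lincomb-+ : ∀ k (t s : Fin k → Carrier) (v : Fin k → Pt) →
                lincomb F k (λ i → t i + s i) v ≋ lincomb F k t v ⊕ lincomb F k s v
    lincomb-+ zero    t s v x = sym (+-identityˡ 0#)
    lincomb-+ (suc k) t s v x =
      trans (+-cong refl (lincomb-+ k (V.tail t) (V.tail s) (V.tail v) x))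
            (solve 5 (λ a b y r r' → (a :+ b) :* y :+ (r :+ r') := (a :* y :+ r) :+ (b :* y :+ r')) refl
                   (t Fin.zero) (s Fin.zero) (v Fin.zero x) _ _)

    lincomb-* : ∀ k a (t : Fin k → Carrier) (v : Fin k → Pt) →
                lincomb F k (λ i → a * t i) v ≋ a ⊙ lincomb F k t v
    lincomb-* zero    a t v x = sym (zeroʳ a)
    lincomb-* (suc k) a t v x =
      trans (+-cong refl (lincomb-* k a (V.tail t) (V.tail v) x))
            (solve 4 (λ a b y r → a :* b :* y :+ a :* r := a :* (b :* y :+ r)) refl
                   a (t Fin.zero) (v Fin.zero x) _)

    lincomb-0 : ∀ k (v : Fin k → Pt) → lincomb F k (λ _ → 0#) v ≋ 0ᵖ F
    lincomb-0 zero    v x = refl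
    lincomb-0 (suc k) v x = trans (+-cong (zeroˡ _) (lincomb-0 k (V.tail v) x)) (+-identityˡ 0#)

    Span : ∀ {k} → (Fin k → Pt) → Pred Pt (c ⊔ ℓ)
    Span {k} v x = ∃ λ t → x ≋ lincomb F k t v

    Span-head : ∀ {k} (w : Fin (suc k) → Pt) → V.head w ∈ Span w
    Span-head {k} w = (1# V.∷ λ _ → 0#) , λ x →
      sym (trans (+-cong (*-identityˡ _) (lincomb-0 k (V.tail w) x)) (+-identityʳ _))

    Span-tail : ∀ {k} (w : Fin (suc k) → Pt) → Span (V.tail w) ⊆ Span w
    Span-tail w (t , x≋) =
      (0# V.∷ t) , λ x → trans (x≋ x) (sym (trans (+-cong (zeroˡ _) refl) (+-identityˡ _)))

    Span-elem : ∀ {k} (w : Fin k → Pt) i → w i ∈ Span w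
    Span-elem w Fin.zero    = Span-head w
    Span-elem w (Fin.suc i) = Span-tail w (Span-elem (V.tail w) i)

    ∑ : ∀ {m} → (Fin m → Pt) → Pt
    ∑ {m} = lincomb F m (λ _ → 1#)

    module _ {k : ℕ} {v : Fin k → Pt} where

      Span-resp : ∀ {x y} → x ≋ y → y ∈ Span v → x ∈ Span v
      Span-resp x≋y (t , y≋) = t , ≋-trans x≋y y≋

      Span-0 : 0ᵖ F ∈ Span v
      Span-0 = (λ _ → 0#) , ≋-sym (lincomb-0 k v)

      Span-+ : ∀ {x y} → x ∈ Span v → y ∈ Span v → x ⊕ y ∈ Span v
      Span-+ (t , x≋) (s , y≋) =
        (λ i → t i + s i) , λ i → trans (+-cong (x≋ i) (y≋ i)) (sym (lincomb-+ k t s v i))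

      Span-* : ∀ a {x} → x ∈ Span v → a ⊙ x ∈ Span v
      Span-* a (t , x≋) =
        (λ i → a * t i) , λ i → trans (*-cong refl (x≋ i)) (sym (lincomb-* k a t v i))

      Span-lincomb : ∀ m (s : Fin m → Carrier) (w : Fin m → Pt) → (∀ i → w i ∈ Span v) →
                     lincomb F m s w ∈ Span v
      Span-lincomb zero    s w w∈ = Span-0
      Span-lincomb (suc m) s w w∈ =
        Span-+ (Span-* (s Fin.zero) (w∈ Fin.zero)) (Span-lincomb m (V.tail s) (V.tail w) (w∈ ∘ Fin.suc))

      Span-⊆ : ∀ {m} {w : Fin m → Pt} → (∀ i → w i ∈ Span v) → Span w ⊆ Span v
      Span-⊆ {m} {w} w∈ (s , x≋) = Span-resp x≋ (Span-lincomb m s w w∈)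

      Span-cancelʳ : ∀ {x y} → x ⊕ y ∈ Span v → y ∈ Span v → x ∈ Span v
      Span-cancelʳ {x} {y} x+y∈ y∈ = Span-resp x≋x+y-y (Span-+ x+y∈ (Span-* (- 1#) y∈))
        where
        x≋x+y-y : x ≋ (x ⊕ y) ⊕ ((- 1#) ⊙ y)
        x≋x+y-y i = trans (sym (//-rightDividesʳ (y i) (x i))) (+-cong refl (sym (-1*x≈-x (y i))))

      Span-cancelˡ : ∀ {x y} → x ⊕ y ∈ Span v → x ∈ Span v → y ∈ Span v
      Span-cancelˡ x+y∈ = Span-cancelʳ (Span-resp (λ i → +-comm _ _) x+y∈)

      Span-∑-missing : ∀ {m} (y : Fin m → Pt) j → ∑ y ∈ Span v → (∀ i → i ≢ j → y i ∈ Span v) →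
                       y j ∈ Span v
      Span-∑-missing {suc m} y Fin.zero ∑∈ y∈ =
        Span-resp (λ x → sym (*-identityˡ _))
          (Span-cancelʳ ∑∈ (Span-lincomb m (λ _ → 1#) (V.tail y) (λ i → y∈ (Fin.suc i) λ ())))
      Span-∑-missing {suc m} y (Fin.suc j) ∑∈ y∈ =
        Span-∑-missing (V.tail y) j (Span-cancelˡ ∑∈ (Span-* 1# (y∈ Fin.zero λ ())))
          (λ i i≢j → y∈ (Fin.suc i) (i≢j ∘ FinP.suc-injective))

    Independent-∷ : ∀ {k} {v : Fin k → Pt} {u} → LinearlyIndependent F k v → u ∉ Span v →
                    LinearlyIndependent F (suc k) (u V.∷ v)
    Independent-∷ {k} {v} {u} ind u∉ t t·v≋0 with t Fin.zero ≟ 0#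
    ... | yes t₀≈0 = λ { Fin.zero → t₀≈0 ; (Fin.suc i) → ind (V.tail t) tail·v≋0 i }
      where
      tail·v≋0 : lincomb F k (V.tail t) v ≋ 0ᵖ F
      tail·v≋0 x =
        trans (sym (trans (+-cong (trans (*-cong t₀≈0 refl) (zeroˡ _)) refl) (+-identityˡ _))) (t·v≋0 x)
    ... | no t₀≉0 with s , t₀s≈1 ← inverse (t Fin.zero) t₀≉0 =
      contradiction (Span-resp u≋ (Span-* (- s) (V.tail t , ≋-refl))) u∉
      where
      open import Relation.Binary.Reasoning.Setoid setoid
      u≋ : u ≋ (- s) ⊙ lincomb F k (V.tail t) v
      u≋ x = sym (begin
        - s * l                                ≈⟨ +-identityʳ _ ⟨
        - s * l + 0#                           ≈⟨ +-cong refl (trans (*-cong refl (t·v≋0 x)) (zeroʳ s)) ⟨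
        - s * l + s * (t Fin.zero * u x + l)   ≈⟨ solve 5 (λ s s' t₀ u l → s' :* l :+ s :* (t₀ :* u :+ l)
                                                           := t₀ :* s :* u :+ (s :+ s') :* l) refl s (- s) _ _ _ ⟩
        t Fin.zero * s * u x + (s - s) * l     ≈⟨ +-cong (*-cong t₀s≈1 refl) (*-cong (-‿inverseʳ s) refl) ⟩
        1# * u x + 0# * l                      ≈⟨ +-cong (*-identityˡ _) (zeroˡ l) ⟩
        u x + 0#                               ≈⟨ +-identityʳ _ ⟩
        u x                                    ∎)
        where l = lincomb F k (V.tail t) v x

    private
      module Points = HasSize (vector-hasSize FiniteField-hasSize d)
      module Coefficients k = HasSize (vector-hasSize FiniteField-hasSize k)

    Span? : ∀ {k} (v : Fin k → Pt) x → Dec (x ∈ Span v)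
    Span? {k} v x = map′ (λ (s , x≋) → C.decode s , x≋)
      (λ (t , x≋) → C.encode t , ≋-trans x≋ (lincomb-cong k v (λ i → sym (C.decode-encode t i))))
      (FinP.any? λ s → x Points.≟ lincomb F k (C.decode s) v)
      where module C = Coefficients k

    -- If all |F|^d points were in the span, two of them would share their coefficients.
    ∃-∉Span : ∀ {j} (v : Fin j → Pt) → j < d → ∃ λ u → u ∉ Span v
    ∃-∉Span {j} v j<d with FinP.all? (λ s → Span? v (Points.decode s))
    ... | no ¬all = let s , s∉ = ¬∀⟶∃¬ _ _ (λ s → Span? v (Points.decode s)) ¬all in Points.decode s , s∉
    ... | yes all
      with s , s' , s<s' , t≋t' ← Coefficients.pigeonhole j (ℕP.^-monoʳ-< card card≥2 j<d) (proj₁ ∘ all) =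
      contradiction (Points.decode-injective (≋-trans (proj₂ (all s))
                       (≋-trans (lincomb-cong j v t≋t') (≋-sym (proj₂ (all s'))))))
                    (FinP.<⇒≢ s<s')

    pad-independent : ∀ n {j} (v : Fin j → Pt) → LinearlyIndependent F j v → n ℕ.+ j ≤ d →
                      ∃ λ (w : Fin (n ℕ.+ j) → Pt) → LinearlyIndependent F (n ℕ.+ j) w × Span v ⊆ Span w
    pad-independent zero    v ind _ = v , ind , id
    pad-independent (suc n) v ind n+j<d
      with w , ind-w , v⊆w ← pad-independent n v ind (ℕP.<⇒≤ n+j<d)
      with u , u∉ ← ∃-∉Span w n+j<d =
      u V.∷ w , Independent-∷ ind-w u∉ , Span-tail (u V.∷ w) ∘ v⊆w

    greedy-independent : ∀ {j} (v : Fin j → Pt) → LinearlyIndependent F j v → ∀ {l} (w : Fin l → Pt) →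
                         ∃₂ λ j' (v' : Fin j' → Pt) → j' ≤ j ℕ.+ l × LinearlyIndependent F j' v' ×
                                                      Span v ⊆ Span v' × (∀ i → w i ∈ Span v')
    greedy-independent {j} v ind {zero}  w = j , v , ℕP.≤-reflexive (≡.sym (ℕP.+-identityʳ j)) , ind , id , λ ()
    greedy-independent {j} v ind {suc l} w with Span? v (V.head w)
    ... | yes w₀∈ with j' , v' , j'≤ , ind' , v⊆ , w∈ ← greedy-independent v ind (V.tail w) =
      j' , v' , ℕP.≤-trans j'≤ (ℕP.+-monoʳ-≤ j (ℕP.n≤1+n l)) , ind' , v⊆ ,
      λ { Fin.zero → v⊆ w₀∈ ; (Fin.suc i) → w∈ i }
    ... | no w₀∉
      with j' , v' , j'≤ , ind' , v⊆ , w∈ ← greedy-independent (V.head w V.∷ v) (Independent-∷ ind w₀∉)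
                                                                (V.tail w) =
      j' , v' , ℕP.≤-trans j'≤ (ℕP.≤-reflexive (≡.sym (ℕP.+-suc j l))) , ind' ,
      v⊆ ∘ Span-tail (V.head w V.∷ v) , λ { Fin.zero → v⊆ (Span-head (V.head w V.∷ v)) ; (Fin.suc i) → w∈ i }

    extend-to-independent : ∀ {k l} (w : Fin l → Pt) → l ≤ k → k ≤ d →
                            ∃ λ (V : Fin k → Pt) → LinearlyIndependent F k V × (∀ i → w i ∈ Span V)
    extend-to-independent {k} w l≤k k≤d
      with j , v , j≤l , ind , _ , w∈ ← greedy-independent V.[] (λ _ _ ()) w
      with j≤k ← ℕP.≤-trans j≤l l≤k
      with V , ind-V , v⊆V ← pad-independent (k ℕ.∸ j) v ind
                                (≡.subst (_≤ d) (≡.sym (ℕP.m∸n+n≡m j≤k)) k≤d) =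
      ≡.subst (λ n → ∃ λ (V : Fin n → Pt) → LinearlyIndependent F n V × (∀ i → w i ∈ Span V))
              (ℕP.m∸n+n≡m j≤k) (V , ind-V , v⊆V ∘ w∈)

    evasive-Span-length≤ : ∀ {k c'} {S : List Pt} → SubspaceEvasive F k c' S → k ≤ d →
                           ∀ {l} (w : Fin l → Pt) → l ≤ k → (T : List Pt) →
                           IsPointSet F T → _⊆ˢ_ F T S → All (_∈ Span w) T → length T ≤ c'
    evasive-Span-length≤ evasive k≤d w l≤k T uniq T⊆S T⊆Span
      with V , ind , w∈ ← extend-to-independent w l≤k k≤d =
      evasive A T uniq T⊆S (All.map (λ x∈ → ∈A (Span-⊆ w∈ x∈)) T⊆Span)
      where
      A : AffineSubspace F d _
      A = record { base = 0ᵖ F ; dir = V ; indep = ind }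

      ∈A : ∀ {x} → x ∈ Span V → _∈ᴬ_ F x A
      ∈A (t , x≋) = t , λ i → trans (x≋ i) (sym (+-identityˡ _))

    record Collision {m g} (p : Fin m → Fin g → Pt) : Set ℓ where
      field
        t t' : Fin m → Fin g
        j    : Fin m
        t≢t' : t j ≢ t' j
        ∑≋∑  : ∑ (λ i → p i (t i)) ≋ ∑ (λ i → p i (t' i))

      Span-missing : ∀ {k} {v : Fin k → Pt} → (∀ i → p i (t i) ∈ Span v) →
                     (∀ i → i ≢ j → p i (t' i) ∈ Span v) → p j (t' j) ∈ Span v
      Span-missing t∈ t'∈ =
        Span-∑-missing (λ i → p i (t' i)) j (Span-resp (≋-sym ∑≋∑) (Span-lincomb _ _ _ t∈)) t'∈

    collision : ∀ {m g} (p : Fin m → Fin g → Pt) → card ℕ.^ d < g ℕ.^ m → Collision p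
    collision {m} {g} p q^d<g^m
      with s , s' , s<s' , ∑≋∑ ← Points.pigeonhole q^d<g^m (λ s → ∑ (λ i → p i (finToFun s i)))
      with j , t≢t' ← ¬∀⟶∃¬ m _ (λ i → finToFun s i Fin.≟ finToFun s' i)
                               (λ eq → FinP.<⇒≢ s<s' (finToFun-injective {m} {g} eq)) =
      record { t = finToFun s ; t' = finToFun s' ; j = j ; t≢t' = t≢t' ; ∑≋∑ = ∑≋∑ }

-- Choosing indices

-- ℕ arithmetic is opened only from here on: its names clash with the field operations above.
open import Data.Nat using (_+_; _*_; _^_; _∸_; _/_; _%_; >-nonZero)
open import Data.Nat.Properties
  using (≤-trans; ≤-reflexive; <⇒≤; <⇒≱; ≰⇒>; _≤?_; +-comm; +-identityʳ; +-cancelˡ-≤;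
         +-monoˡ-≤; +-monoʳ-≤; *-comm; *-monoˡ-≤; *-monoʳ-≤; *-identityʳ; m≤m+n; m≤n*m;
         m+n∸m≡n; ∸-monoˡ-≤; m≤n⇒m⊓n≡m; m+[n∸m]≡n; ^-monoˡ-≤; m^n>0)
open import Data.Nat.DivMod using (m/n*n≤m; m≡m%n+[m/n]*n; m%n<n; m≥n⇒m/n>0)
open import Data.Empty using (⊥)
open import Data.Sum using (inj₁; inj₂; [_,_]′)
open import Data.List.Membership.Propositional using (_∈_; _∉_)
open import Data.List.Membership.Propositional.Properties
  using (∈-filter⁺; ∈-filter⁻; ∈-allFin; ∈-tabulate⁺; ∈-tabulate⁻)
open import Data.List.Membership.Setoid.Properties using () renaming (∈-lookup to ∈ₛ-lookup)
import Data.List.Relation.Unary.All.Properties as AllP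
open import Data.List.Relation.Unary.Any.Properties using (++⁺ˡ; ++⁺ʳ; ++⁻)
open import Data.List.Relation.Unary.Unique.Propositional using (Unique)
import Data.List.Relation.Unary.Unique.Propositional.Properties as Unique
import Data.List.Relation.Unary.Unique.Setoid.Properties as UniqueS
open import Relation.Nullary using (¬?)

module _ {a} {A : Set a} where

  ∈-take⁻ : ∀ {x : A} j xs → x ∈ take j xs → x ∈ xs
  ∈-take⁻ j xs x∈ = ≡.subst (_ ∈_) (take++drop≡id j xs) (++⁺ˡ x∈)

  tabulate₂ : ∀ {r m} → (Fin r → Fin m → A) → List A
  tabulate₂ {m = m} f = tabulate (uncurry f ∘ remQuot m)

  length-tabulate₂ : ∀ {r m} (f : Fin r → Fin m → A) → length (tabulate₂ f) ≡ r * m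
  length-tabulate₂ f = length-tabulate _

  ∈-tabulate₂⁺ : ∀ {r m} (f : Fin r → Fin m → A) b i → f b i ∈ tabulate₂ f
  ∈-tabulate₂⁺ f b i =
    ≡.subst (_∈ tabulate₂ f) (cong (uncurry f) (remQuot-combine b i)) (∈-tabulate⁺ (combine b i))

module _ {n : ℕ} where
  open import Data.List.Membership.DecPropositional (Fin._≟_ {n}) using (_∈?_)

  record AvoidingCover (k : ℕ) (Z N : List (Fin n)) : Set where
    field
      D       : List (Fin n)
      unique  : Unique D
      length≡ : length D ≡ k
      avoids  : ∀ {x} → x ∈ D → x ∉ Z
      covers  : ∀ {x} → x ∈ N → x ∉ Z → x ∈ D

  choose-avoiding : ∀ k (Z N : List (Fin n)) → length Z + k ≤ n → length N ≤ k → AvoidingCover k Z N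
  choose-avoiding k Z N Z+k≤n N≤k = record
    { D = D ; unique = unique-D ; length≡ = length-D ; avoids = D∌Z ; covers = N⊆D }
    where
    ∉Z? : ∀ x → Dec (x ∉ Z)
    ∉Z? x = ¬? (x ∈? Z)
    ∈N? : ∀ x → Dec (x ∈ N)
    ∈N? x = x ∈? N
    ∉N? : ∀ x → Dec (x ∉ N)
    ∉N? x = ¬? (x ∈? N)

    L P Q D : List (Fin n)
    L = filter ∉Z? (allFin n)
    P = filter ∈N? L
    Q = filter ∉N? L
    D = P ++ take (k ∸ length P) Q

    ∈L : ∀ {x} → x ∉ Z → x ∈ L
    ∈L {x} = ∈-filter⁺ ∉Z? (∈-allFin x)

    L∌Z : ∀ {x} → x ∈ L → x ∉ Z
    L∌Z = proj₂ ∘ ∈-filter⁻ ∉Z? {xs = allFin n}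

    unique-L : Unique L
    unique-L = Unique.filter⁺ _ (Unique.allFin⁺ n)

    length-P≤k : length P ≤ k
    length-P≤k = ≤-trans (Unique-length-≤ (≡.setoid (Fin n)) (Unique.filter⁺ _ unique-L)
                                         (proj₂ ∘ ∈-filter⁻ ∈N? {xs = L}))
                         N≤k

    ∈Z++P++Q : ∀ x → x ∈ Z ++ P ++ Q
    ∈Z++P++Q x with x ∈? Z | x ∈? N
    ... | yes x∈Z | _       = ++⁺ˡ x∈Z
    ... | no  x∉Z | yes x∈N = ++⁺ʳ Z (++⁺ˡ (∈-filter⁺ ∈N? (∈L x∉Z) x∈N))
    ... | no  x∉Z | no  x∉N = ++⁺ʳ Z (++⁺ʳ P (∈-filter⁺ ∉N? (∈L x∉Z) x∉N))

    k≤P+Q : k ≤ length P + length Q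
    k≤P+Q = +-cancelˡ-≤ (length Z) _ _ (begin
      length Z + k                      ≤⟨ Z+k≤n ⟩
      n                                 ≡⟨ length-tabulate id ⟨
      length (allFin n)                 ≤⟨ Unique-length-≤ (≡.setoid (Fin n)) (Unique.allFin⁺ n) (λ _ → ∈Z++P++Q _) ⟩
      length (Z ++ P ++ Q)              ≡⟨ ≡.trans (length-++ Z) (cong (length Z +_) (length-++ P)) ⟩
      length Z + (length P + length Q)  ∎)
      where open Data.Nat.Properties.≤-Reasoning

    length-D : length D ≡ k
    length-D = begin
      length D                                     ≡⟨ length-++ P ⟩
      length P + length (take (k ∸ length P) Q)    ≡⟨ cong (length P +_) (length-take _ Q) ⟩
      length P + ((k ∸ length P) ℕ.⊓ length Q)     ≡⟨ cong (length P +_) (m≤n⇒m⊓n≡m k∸P≤Q) ⟩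
      length P + (k ∸ length P)                    ≡⟨ m+[n∸m]≡n length-P≤k ⟩
      k                                            ∎
      where
      open ≡.≡-Reasoning
      k∸P≤Q : k ∸ length P ≤ length Q
      k∸P≤Q = ≤-trans (∸-monoˡ-≤ (length P) k≤P+Q) (≤-reflexive (m+n∸m≡n (length P) (length Q)))

    unique-D : Unique D
    unique-D = Unique.++⁺ (Unique.filter⁺ _ unique-L) (Unique.take⁺ _ (Unique.filter⁺ _ unique-L))
      λ (x∈P , x∈Q) → proj₂ (∈-filter⁻ ∉N? {xs = L} (∈-take⁻ _ Q x∈Q))
                             (proj₂ (∈-filter⁻ ∈N? {xs = L} x∈P))

    D∌Z : ∀ {x} → x ∈ D → x ∉ Z
    D∌Z x∈D with ++⁻ P x∈D
    ... | inj₁ x∈P = L∌Z (proj₁ (∈-filter⁻ ∈N? {xs = L} x∈P))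
    ... | inj₂ x∈Q = L∌Z (proj₁ (∈-filter⁻ ∉N? {xs = L} (∈-take⁻ _ Q x∈Q)))

    N⊆D : ∀ {x} → x ∈ N → x ∉ Z → x ∈ D
    N⊆D x∈N x∉Z = ++⁺ˡ (∈-filter⁺ ∈N? (∈L x∉Z) x∈N)

-- The block argument

n≤m⇒m≤2*n*[m/n] : ∀ {m n} .{{_ : NonZero n}} → n ≤ m → m ≤ 2 * n * (m / n)
n≤m⇒m≤2*n*[m/n] {m} {n} n≤m = begin
  m                          ≡⟨ m≡m%n+[m/n]*n m n ⟩
  m % n + m / n * n          ≤⟨ +-monoˡ-≤ (m / n * n) (<⇒≤ (m%n<n m n)) ⟩
  n + m / n * n              ≤⟨ +-monoˡ-≤ (m / n * n) (m≤n*m n (m / n) {{>-nonZero (m≥n⇒m/n>0 n≤m)}}) ⟩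
  m / n * n + m / n * n      ≡⟨ solve 2 (λ n q → q :* n :+ q :* n := con 2 :* n :* q) ≡.refl n (m / n) ⟩
  2 * n * (m / n)            ∎
  where
  open Data.Nat.Properties.≤-Reasoning
  open import Data.Nat.Solver using (module +-*-Solver)
  open +-*-Solver

^-distribʳ-* : ∀ x y n → (x * y) ^ n ≡ x ^ n * y ^ n
^-distribʳ-* x y zero    = ≡.refl
^-distribʳ-* x y (suc n) = ≡.trans (cong (x * y *_) (^-distribʳ-* x y n)) (interchange x y (x ^ n) (y ^ n))
  where open import Algebra.Properties.CommutativeSemigroup ℕP.*-commutativeSemigroup using (interchange)

module _ {c ℓ} (F : FiniteField c ℓ) {k d C : ℕ} .{{_ : NonZero k}} (k≤d : k ≤ d)
         {S : List (Point F d)} (unique-S : IsPointSet F S) (evasive : SubspaceEvasive F k (k + C) S) where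
  open FiniteField F using (card)

  private
    module Blocks (m : ℕ) (2rm≤k : 2 * (suc C * m) ≤ k) (k+r≤n : k + suc C ≤ length S)
                  (q^d<g^m : card ^ d < (length S / k) ^ m) where
      r n g : ℕ
      r = suc C
      n = length S
      g = n / k

      layout : r * m * g ≤ n
      layout = begin
        r * m * g   ≤⟨ *-monoˡ-≤ g (≤-trans (m≤m+n (r * m) (r * m + 0)) 2rm≤k) ⟩
        k * g       ≡⟨ *-comm k g ⟩
        g * k       ≤⟨ m/n*n≤m n k ⟩
        n           ∎
        where open Data.Nat.Properties.≤-Reasoning

      -- the x-th point of group i of block b
      ι : Fin r → Fin m → Fin g → Fin n
      ι b i x = Fin.inject≤ (combine (combine b i) x) layout

      ι-injective : ∀ {b i x b' i' x'} → ι b i x ≡ ι b' i' x' → b ≡ b' × i ≡ i' × x ≡ x'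
      ι-injective eq
        with bi≡ , x≡ ← FinP.combine-injective _ _ _ _ (FinP.inject≤-injective layout layout _ _ eq)
        with b≡ , i≡ ← FinP.combine-injective _ _ _ _ bi≡ = b≡ , i≡ , x≡

      module Block (b : Fin r) = Collision (collision F (λ i x → lookup S (ι b i x)) q^d<g^m)
      open Block using (t; t'; j)

      z : Fin r → Fin n
      z b = ι b (j b) (t' b (j b))

      u u' : Fin r → Fin m → Fin n
      u  b i = ι b i (t b i)
      u' b i = ι b i (t' b i)

      Z N : List (Fin n)
      Z = tabulate z
      N = tabulate₂ u ++ tabulate₂ u'

      ι∈Z : ∀ {b i x} → ι b i x ∈ Z → i ≡ j b × x ≡ t' b i
      ι∈Z {b} {i} {x} x∈Z with b' , eq ← ∈-tabulate⁻ x∈Z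
        with ≡.refl , ≡.refl , x≡ ← ι-injective {b} {i} {x} {b'} {j b'} {t' b' (j b')} eq = ≡.refl , x≡

      u∉Z : ∀ b i → u b i ∉ Z
      u∉Z b i u∈Z = let i≡j , t≡t' = ι∈Z {b} u∈Z in
                    Block.t≢t' b (≡.subst (λ i → t b i ≡ t' b i) i≡j t≡t')

      u'∉Z : ∀ b i → i ≢ j b → u' b i ∉ Z
      u'∉Z b i i≢j = i≢j ∘ proj₁ ∘ ι∈Z {b}

      length-Z+k≤n : length Z + k ≤ n
      length-Z+k≤n = ≤-trans (≤-reflexive (≡.trans (cong (_+ k) (length-tabulate z)) (+-comm r k))) k+r≤n

      length-N≤k : length N ≤ k
      length-N≤k = ≤-trans (≤-reflexive (≡.trans (length-++ (tabulate₂ u))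
                                          (≡.cong₂ _+_ (length-tabulate₂ u) (length-tabulate₂ u'))))
                           (≤-trans (≤-reflexive (cong (r * m +_) (≡.sym (+-identityʳ (r * m))))) 2rm≤k)

      open AvoidingCover (choose-avoiding k Z N length-Z+k≤n length-N≤k)

      w : Fin (length D) → Point F d
      w i = lookup S (lookup D i)

      D-Span : ∀ {x} → x ∈ D → Span F w (lookup S x)
      D-Span x∈D = ≡.subst (Span F w ∘ lookup S) (≡.sym (lookup-index x∈D)) (Span-elem F w (index x∈D))

      z-Span : ∀ b → Span F w (lookup S (z b))
      z-Span b = Block.Span-missing b
        (λ i → D-Span (covers (++⁺ˡ (∈-tabulate₂⁺ u b i)) (u∉Z b i)))
        (λ i i≢j → D-Span (covers (++⁺ʳ (tabulate₂ u) (∈-tabulate₂⁺ u' b i)) (u'∉Z b i i≢j)))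

      T : List (Point F d)
      T = map (lookup S) (Z ++ D)

      unique-T : IsPointSet F T
      unique-T = UniqueS.map⁺ (≡.setoid (Fin n)) (pointSetoid F d) (Unique-lookup-injective (pointSetoid F d) unique-S)
        (Unique.++⁺ (Unique.tabulate⁺ z-injective) unique λ (x∈Z , x∈D) → avoids x∈D x∈Z)
        where
        z-injective : ∀ {b b'} → z b ≡ z b' → b ≡ b'
        z-injective {b} {b'} = proj₁ ∘ ι-injective {b} {j b} {t' b (j b)} {b'} {j b'} {t' b' (j b')}

      T⊆S : _⊆ˢ_ F T S
      T⊆S = AllP.map⁺ (All.universal (∈ₛ-lookup (pointSetoid F d) S) (Z ++ D))

      T-Span : All (Span F w) T
      T-Span = AllP.map⁺ (All.tabulate λ x∈ → [ Z-Span , D-Span ]′ (++⁻ Z x∈))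
        where
        Z-Span : ∀ {x} → x ∈ Z → Span F w (lookup S x)
        Z-Span x∈Z =
          let b , x≡zb = ∈-tabulate⁻ {f = z} x∈Z in ≡.subst (Span F w ∘ lookup S) (≡.sym x≡zb) (z-Span b)

      length-T : length T ≡ r + k
      length-T = ≡.trans (length-map (lookup S) (Z ++ D))
                         (≡.trans (length-++ Z) (≡.cong₂ _+_ (length-tabulate z) length≡))

      absurd : ⊥
      absurd = <⇒≱ (≤-reflexive (cong suc (+-comm k C)))
                   (≤-trans (≤-reflexive (≡.sym length-T))
                            (evasive-Span-length≤ F evasive k≤d w (≤-reflexive length≡) T unique-T T⊆S T-Span))

  [length/k]^m≤card^d : ∀ {m} → 2 * (suc C * m) ≤ k → k + suc C ≤ length S → (length S / k) ^ m ≤ card ^ d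
  [length/k]^m≤card^d {m} 2rm≤k k+r≤n = ≮⇒≥ (Blocks.absurd m 2rm≤k k+r≤n)

  length^m≤[2k]^m*card^d : ∀ {m} → 2 * suc C ≤ k → 2 * (suc C * m) ≤ k →
                           length S ^ m ≤ (2 * k) ^ m * card ^ d
  length^m≤[2k]^m*card^d {m} 2r≤k 2rm≤k with 2 * k ≤? length S
  ... | yes 2k≤n = begin
    length S ^ m                       ≤⟨ ^-monoˡ-≤ m (n≤m⇒m≤2*n*[m/n] k≤n) ⟩
    (2 * k * (length S / k)) ^ m       ≡⟨ ^-distribʳ-* (2 * k) (length S / k) m ⟩
    (2 * k) ^ m * (length S / k) ^ m   ≤⟨ *-monoʳ-≤ ((2 * k) ^ m) ([length/k]^m≤card^d {m} 2rm≤k k+r≤n) ⟩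
    (2 * k) ^ m * card ^ d             ∎
    where
    open Data.Nat.Properties.≤-Reasoning
    k≤n : k ≤ length S
    k≤n = ≤-trans (m≤m+n k (k + 0)) 2k≤n
    k+r≤n : k + suc C ≤ length S
    k+r≤n = ≤-trans (+-monoʳ-≤ k (≤-trans (m≤m+n (suc C) (suc C + 0))
                                          (≤-trans 2r≤k (≤-reflexive (≡.sym (+-identityʳ k)))))) 2k≤n
  ... | no 2k≰n = begin
    length S ^ m                       ≤⟨ ^-monoˡ-≤ m (<⇒≤ (≰⇒> 2k≰n)) ⟩
    (2 * k) ^ m                        ≡⟨ *-identityʳ _ ⟨
    (2 * k) ^ m * 1                    ≤⟨ *-monoʳ-≤ ((2 * k) ^ m) (m^n>0 card {{card≢0}} d) ⟩
    (2 * k) ^ m * card ^ d             ∎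
    where
    open Data.Nat.Properties.≤-Reasoning
    card≢0 : NonZero card
    card≢0 = >-nonZero (≤-trans (s≤s z≤n) (card≥2 F))

theorem1p2 : ∀ {c ℓ} (F : FiniteField c ℓ) (k d C : ℕ) → 1 ≤ k → 1 ≤ d → k ≤ d →
    2 * (C + 1) ≤ k →
    (S : List (Point F d)) → IsPointSet F S → SubspaceEvasive F k (k + C) S →
    length S ^ (k / (2 * suc C)) ≤ (4 * k) ^ (k / (2 * suc C)) * FiniteField.card F ^ d
theorem1p2 F k d C 1≤k _ k≤d 2[C+1]≤k S unique-S evasive = begin
  length S ^ m            ≤⟨ length^m≤[2k]^m*card^d F {{>-nonZero 1≤k}} k≤d unique-S evasive {m} 2r≤k 2rm≤k ⟩
  (2 * k) ^ m * card ^ d  ≤⟨ *-monoˡ-≤ (card ^ d) (^-monoˡ-≤ m (*-monoˡ-≤ k {2} {4} (s≤s (s≤s z≤n)))) ⟩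
  (4 * k) ^ m * card ^ d  ∎
  where
  open Data.Nat.Properties.≤-Reasoning
  open FiniteField F using (card)

  m : ℕ
  m = k / (2 * suc C)

  2r≤k : 2 * suc C ≤ k
  2r≤k = ≡.subst (λ r → 2 * r ≤ k) (+-comm C 1) 2[C+1]≤k

  2rm≤k : 2 * (suc C * m) ≤ k
  2rm≤k = ≤-trans (≤-reflexive (solve 2 (λ r m → con 2 :* (r :* m) := m :* (con 2 :* r)) ≡.refl (suc C) m))
                  (m/n*n≤m k (2 * suc C))
    where open import Data.Nat.Solver using (module +-*-Solver)
          open +-*-Solver
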